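{- For every integer $n\ge 4$ and every integer $t$ with $2\le t\le n-3$, $\mathrm{wdim}_{2n-2t}(K_n\times K_n)=n^2-tn$.
   Context: $K_n\times K_n$ is the direct product of two complete graphs: vertex set $[n]\times[n]$ with $[n]=\{1,\dots,n\}$, where $(i,j)$ and $(i',j')$ are adjacent iff $i\ne i'$ and $j\ne j'$. With $d$ the shortest-path distance, for $S\subseteq V$ and vertices $x,y,z$: $\Delta_z(x,y)=|d(x,z)-d(y,z)|$ and $\Delta_S(x,y)=\sum_{z\in S}\Delta_z(x,y)$. A set $S$ of vertices is a weak $k$-resolving set if $\Delta_S(x,y)\ge k$ for all distinct vertices $x,y$. The weak $k$-metric dimension $\mathrm{wdim}_k(G)$ is the minimum cardinality of a weak $k$-resolving set of $G$. -}

module Defs where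

open import Data.Nat using (ℕ; zero; suc; _+_; _≤_; ∣_-_∣)
open import Data.Bool using (Bool; true; false; _∧_; _∨_; not; if_then_else_; T?)
open import Data.Bool.ListAction using (any)
open import Data.Nat.ListAction using (sum)
open import Data.Fin using (Fin)
open import Data.Fin.Properties using () renaming (_≟_ to _≟ᶠ_)
open import Data.List using (List; length; filter; map; allFin; cartesianProduct)
open import Data.Product using (_×_; _,_)
open import Relation.Nullary using (¬_; does)
open import Relation.Binary.PropositionalEquality using (_≡_)

record FinGraph : Set₁ where
  field
    V     : Set
    verts : List V            -- enumeration of the whole vertex set
    adj   : V → V → Bool
    eqV   : V → V → Bool

module _ (G : FinGraph) where
  open FinGraph G

  reach : ℕ → V → V → Bool
  reach zero    x y = eqV x y
  reach (suc k) x y = reach k x y ∨ any (λ z → reach k x z ∧ adj z y) verts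

  search : ℕ → ℕ → V → V → ℕ
  search i zero       x y = i
  search i (suc fuel) x y = if reach i x y then i else search (suc i) fuel x y

  -- shortest-path distance d(x,y) (a shortest path has length < |V|;
  -- for disconnected pairs this returns |V|, which never occurs in the
  -- connected graphs considered here)
  dist : V → V → ℕ
  dist x y = search 0 (length verts) x y

  card : (V → Bool) → ℕ
  card S = length (filter (λ v → T? (S v)) verts)

  ΔS : (V → Bool) → V → V → ℕ
  ΔS S x y = sum (map (λ z → if S z then ∣ dist x z - dist y z ∣ else 0) verts)

  IsWeakKResolving : ℕ → (V → Bool) → Set
  IsWeakKResolving k S = ∀ (x y : V) → ¬ (x ≡ y) → k ≤ ΔS S x y

  WDimIs : ℕ → ℕ → Set
  WDimIs k m =
    (Data.Product.Σ (V → Bool) λ S → IsWeakKResolving k S × card S ≡ m)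
    × (∀ (S : V → Bool) → IsWeakKResolving k S → m ≤ card S)

KnxKn : ℕ → FinGraph
KnxKn n = record
  { V     = Fin n × Fin n
  ; verts = cartesianProduct (allFin n) (allFin n)
  ; adj   = λ { (i , j) (i' , j') → not (does (i ≟ᶠ i')) ∧ not (does (j ≟ᶠ j')) }
  ; eqV   = λ { (i , j) (i' , j') → does (i ≟ᶠ i') ∧ does (j ≟ᶠ j') }
  }

-- In K_n × K_n with n ≥ 3, the distance from (i , j) to (a , b) is 0, 1 or 2 according as both,
-- neither or exactly one of i = a, j = b hold.  Hence for x = (i , j) and y = (i , j'),
-- Δ_S(x, y) = |S ∩ column j| + |S ∩ column j'| + [x ∈ S] + [y ∈ S] (dually for a common column),
-- and for adjacent x, y the four line counts of S sum to at most Δ_S(x, y) + 6.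
--
-- Upper bound: the complement of the circulant {(a , b) : (a + b) mod n < t} meets every line
-- in n − t ≥ 3 points, so it is a weak (2n − 2t)-resolving set of size n² − tn.
--
-- Lower bound: let A be the complement of a weak (2n − 2t)-resolving set, with column sums c_j and
-- row sums r_i.  Pairs in a common row give c_j + c_j' ≤ 2t + [A_ij = 0] + [A_ij' = 0] for
-- j ≠ j', and dually for rows.  Suppose |A| > tn and pick a column a with c_a > t and a row i with
-- A_ia = 1.  Summing the bound for a and each j along row i gives
-- (n − 2)(c_a − t − 1) + |A| + r_i ≤ tn + 2, so no line holds t + 2 entries of A and r_i ≤ 1.
-- By the dual bound, two rows with more than t entries would both be empty, so at most one row
-- exceeds t, and |A| ≤ 1 + (t + 1) + (n − 2)t, which contradicts |A| > tn when t ≥ 2.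

module Submission where

open import Defs
open import Data.Bool using (Bool; true; false; not; _∧_; T; T?; if_then_else_)
open import Data.Bool.Properties using (T-∧; T-∨; not-involutive)
open import Data.Fin using (Fin; zero; suc; toℕ; inject₁; fromℕ)
open import Data.Fin.Properties using (_≟_; any?; toℕ<n; toℕ-inject₁; toℕ-fromℕ)
open import Data.Nat using (ℕ; zero; suc; _+_; _*_; _∸_; ∣_-_∣; _≤_; _<_; >-nonZero; z≤n; s≤s; z<s; s<s; _<?_; _<ᵇ_; NonZero; _%_)
open import Data.Nat.DivMod using ([m+n]%n≡m%n; m<n⇒m%n≡m)
open import Data.Nat.Tactic.RingSolver using (solve-∀)
open import Data.Nat.Properties hiding (_≟_)
open import Algebra.Properties.Semiring.Sum +-*-semiring
  using (sum-syntax; sum-cong-≗; sum-replicate-zero; sum-init-last; ∑-distrib-+; ∑-comm; *-distribˡ-sum)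
open import Data.List using ([]; _∷_; _++_; length; map; filter; tabulate; allFin; cartesianProduct)
open import Data.List.Properties using (map-++; map-∘)
open import Data.Nat.ListAction using (sum)
open import Data.Nat.ListAction.Properties using (sum-++)
open import Data.List.Membership.Propositional.Properties using (∈-cartesianProduct⁺; ∈-allFin)
open import Data.List.Membership.Propositional using (_∈_)
import Data.List.Relation.Unary.Any as Any
open import Data.List.Relation.Unary.Any.Properties using (any⁺; any⁻)
open import Data.Product as Product using (∃-syntax; _×_; _,_; proj₁; proj₂; curry; uncurry; swap)
open import Data.Sum as Sum using (_⊎_; inj₁; inj₂)
open import Function using (_∘_; Equivalence)
open import Relation.Binary.PropositionalEquality
open import Relation.Nullary using (¬_; Dec; does; yes; no; contradiction)
open import Relation.Nullary.Decidable using (dec-true; dec-false)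
open import Data.Empty using (⊥-elim)

iverson : Bool → ℕ
iverson true  = 1
iverson false = 0

iverson≤1 : ∀ b → iverson b ≤ 1
iverson≤1 true  = ≤-refl
iverson≤1 false = z≤n

iverson>0⇒T : ∀ {b} → 0 < iverson b → T b
iverson>0⇒T {true} _ = _

T⇒iverson≡1 : ∀ {b} → T b → iverson b ≡ 1
T⇒iverson≡1 {true} _ = refl

T⇒iverson-not≡0 : ∀ {b} → T b → iverson (not b) ≡ 0
T⇒iverson-not≡0 {true} _ = refl

2≤iverson-not⇒iverson≡0 : ∀ b b' → 2 ≤ iverson (not b) + iverson (not b') → iverson b ≡ 0
2≤iverson-not⇒iverson≡0 false _     _         = refl
2≤iverson-not⇒iverson≡0 true  true  ()
2≤iverson-not⇒iverson≡0 true  false (s≤s ())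

if-then-0≡*iverson : ∀ b v → (if b then v else 0) ≡ v * iverson b
if-then-0≡*iverson true  v = sym (*-identityʳ v)
if-then-0≡*iverson false v = sym (*-zeroʳ v)

δ : ∀ {n} → Fin n → Fin n → ℕ
δ i j = iverson (does (i ≟ j))

-- sum-cong-≗ cannot recover the length from a ∑[ i < n ] goal; this restatement can.
∑-cong : ∀ {n} {f g : Fin n → ℕ} → (∀ i → f i ≡ g i) → ∑[ i < n ] f i ≡ ∑[ i < n ] g i
∑-cong {n} = sum-cong-≗ {n}

∑-δ : ∀ {n} (i : Fin n) (f : Fin n → ℕ) → ∑[ j < n ] (δ i j * f j) ≡ f i
∑-δ {suc n} zero    f = trans (cong₂ _+_ (+-identityʳ (f zero)) (sum-replicate-zero n)) (+-identityʳ (f zero))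
∑-δ {suc n} (suc i) f = ∑-δ i (f ∘ suc)

∑-δ₁ : ∀ {n} (i : Fin n) → ∑[ j < n ] δ i j ≡ 1
∑-δ₁ {n} i = trans (∑-cong (λ j → sym (*-identityʳ (δ i j)))) (∑-δ i (λ _ → 1))

∑-const : ∀ n x → ∑[ i < n ] x ≡ n * x
∑-const zero    x = refl
∑-const (suc n) x = cong (x +_) (∑-const n x)

∑-mono-≤ : ∀ {n} {f g : Fin n → ℕ} → (∀ i → f i ≤ g i) → ∑[ i < n ] f i ≤ ∑[ i < n ] g i
∑-mono-≤ {zero}  f≤g = z≤n
∑-mono-≤ {suc n} f≤g = +-mono-≤ (f≤g zero) (∑-mono-≤ (f≤g ∘ suc))

term≤∑ : ∀ {n} (f : Fin n → ℕ) i → f i ≤ ∑[ j < n ] f j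
term≤∑ f zero    = m≤m+n (f zero) _
term≤∑ f (suc i) = ≤-trans (term≤∑ (f ∘ suc) i) (m≤n+m _ (f zero))

∑>⇒∃> : ∀ {n t} (f : Fin n → ℕ) → t * n < ∑[ i < n ] f i → ∃[ i ] t < f i
∑>⇒∃> {n} {t} f tn<∑ with any? (λ i → t <? f i)
... | yes witness = witness
... | no  none    = contradiction tn<∑ (≤⇒≯ (begin
  ∑[ i < n ] f i ≤⟨ ∑-mono-≤ (λ i → ≮⇒≥ (none ∘ (i ,_))) ⟩
  ∑[ i < n ] t   ≡⟨ ∑-const n t ⟩
  n * t          ≡⟨ *-comm n t ⟩
  t * n          ∎))
  where open ≤-Reasoning

∑-<ᵇ : ∀ {n t} → t ≤ n → ∑[ i < n ] iverson (toℕ i <ᵇ t) ≡ t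
∑-<ᵇ {zero}  z≤n = refl
∑-<ᵇ {suc n} {zero}  _         = sum-replicate-zero (suc n)
∑-<ᵇ {suc n} {suc t} (s≤s t≤n) = cong suc (∑-<ᵇ t≤n)

∑-shift-periodic : ∀ {n} (f : ℕ → ℕ) → (∀ x → f (x + n) ≡ f x) →
                   ∀ s → ∑[ i < n ] f (s + toℕ i) ≡ ∑[ i < n ] f (toℕ i)
∑-shift-periodic     f periodic zero    = refl
∑-shift-periodic {n} f periodic (suc s) = trans (shift₁ n periodic) (∑-shift-periodic f periodic s)
  where
  shift₁ : ∀ n → (∀ x → f (x + n) ≡ f x) → ∑[ i < n ] f (suc s + toℕ i) ≡ ∑[ i < n ] f (s + toℕ i)
  shift₁ zero    _        = refl
  shift₁ (suc m) periodic = begin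
    ∑[ i < suc m ] f (suc s + toℕ i)
      ≡⟨ sum-init-last (λ i → f (suc s + toℕ i)) ⟩
    ∑[ i < m ] f (suc s + toℕ (inject₁ i)) + f (suc s + toℕ (fromℕ m))
      ≡⟨ cong₂ _+_ (∑-cong {m} (λ i → cong (λ k → f (suc s + k)) (toℕ-inject₁ i)))
                   (cong (λ k → f (suc s + k)) (toℕ-fromℕ m)) ⟩
    ∑[ i < m ] f (suc s + toℕ i) + f (suc (s + m))
      ≡⟨ cong (∑[ i < m ] f (suc s + toℕ i) +_) (trans (cong f (sym (+-suc s m))) (periodic s)) ⟩
    ∑[ i < m ] f (suc s + toℕ i) + f s
      ≡⟨ +-comm (∑[ i < m ] f (suc s + toℕ i)) (f s) ⟩
    f s + ∑[ i < m ] f (suc s + toℕ i)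
      ≡⟨ cong₂ _+_ (cong f (sym (+-identityʳ s))) (∑-cong {m} (λ i → cong f (sym (+-suc s (toℕ i))))) ⟩
    ∑[ i < suc m ] f (s + toℕ i)
      ∎
    where open ≡-Reasoning

∑-nearlyBounded : ∀ {n t} (f : Fin n → ℕ) i₀ → f i₀ ≤ 1 → (∀ i → f i ≤ suc t) →
                  (∀ {i i'} → t < f i → t < f i' → i ≡ i') → ∑[ i < n ] f i + t ≤ t * n + 2
∑-nearlyBounded {n} {t} f i₀ fi₀≤1 f≤1+t excess-unique = begin
  ∑[ i < n ] f i + t
    ≡⟨ cong (∑[ i < n ] f i +_) (∑-δ i₀ (λ _ → t)) ⟨
  ∑[ i < n ] f i + ∑[ i < n ] (δ i₀ i * t)
    ≡⟨ ∑-distrib-+ f (λ i → δ i₀ i * t) ⟨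
  ∑[ i < n ] (f i + δ i₀ i * t)
    ≤⟨ ∑-mono-≤ pointwise ⟩
  ∑[ i < n ] (t + δ b i + δ i₀ i)
    ≡⟨ ∑-distrib-+ (λ i → t + δ b i) (δ i₀) ⟩
  ∑[ i < n ] (t + δ b i) + ∑[ i < n ] δ i₀ i
    ≡⟨ cong₂ _+_ (∑-distrib-+ (λ _ → t) (δ b)) (∑-δ₁ i₀) ⟩
  ∑[ i < n ] t + ∑[ i < n ] δ b i + 1
    ≡⟨ cong₂ (λ x y → x + y + 1) (trans (∑-const n t) (*-comm n t)) (∑-δ₁ b) ⟩
  t * n + 1 + 1
    ≡⟨ +-assoc (t * n) 1 1 ⟩
  t * n + 2
    ∎
  where
  open ≤-Reasoning
  onlyExcess : ∃[ b ] ∀ i → f i ≤ t + δ b i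
  onlyExcess with any? (λ i → t <? f i)
  ... | no  none       = i₀ , λ i → ≤-trans (≮⇒≥ (none ∘ (i ,_))) (m≤m+n t _)
  ... | yes (b , t<fb) = b , bounded
    where
    bounded : ∀ i → f i ≤ t + δ b i
    bounded i with b ≟ i
    ... | yes refl = subst (f b ≤_) (+-comm 1 t) (f≤1+t b)
    ... | no  b≢i  = subst (f i ≤_) (sym (+-identityʳ t)) (≮⇒≥ (λ t<fi → b≢i (excess-unique t<fb t<fi)))
  b = proj₁ onlyExcess
  pointwise : ∀ i → f i + δ i₀ i * t ≤ t + δ b i + δ i₀ i
  pointwise i with i₀ ≟ i
  ... | yes refl = begin
    f i + 1 * t     ≤⟨ +-monoˡ-≤ (1 * t) fi₀≤1 ⟩
    1 + 1 * t       ≡⟨ cong suc (*-identityˡ t) ⟩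
    1 + t           ≡⟨ +-comm 1 t ⟩
    t + 1           ≤⟨ +-monoˡ-≤ 1 (m≤m+n t (δ b i)) ⟩
    t + δ b i + 1   ∎
  ... | no  _    = subst₂ _≤_ (sym (+-identityʳ (f i))) (sym (+-identityʳ _)) (proj₂ onlyExcess i)

sum-map-tabulate : ∀ {A : Set} {n} (f : A → ℕ) (g : Fin n → A) → sum (map f (tabulate g)) ≡ ∑[ i < n ] f (g i)
sum-map-tabulate {n = zero}  f g = refl
sum-map-tabulate {n = suc n} f g = cong (f (g zero) +_) (sum-map-tabulate f (g ∘ suc))

sum-map-cartesianProduct : ∀ {A B : Set} (f : A × B → ℕ) xs ys →
  sum (map f (cartesianProduct xs ys)) ≡ sum (map (λ x → sum (map (λ y → f (x , y)) ys)) xs)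
sum-map-cartesianProduct f []       ys = refl
sum-map-cartesianProduct f (x ∷ xs) ys = begin
  sum (map f (map (x ,_) ys ++ cartesianProduct xs ys))
    ≡⟨ cong sum (map-++ f (map (x ,_) ys) (cartesianProduct xs ys)) ⟩
  sum (map f (map (x ,_) ys) ++ map f (cartesianProduct xs ys))
    ≡⟨ sum-++ (map f (map (x ,_) ys)) (map f (cartesianProduct xs ys)) ⟩
  sum (map f (map (x ,_) ys)) + sum (map f (cartesianProduct xs ys))
    ≡⟨ cong₂ _+_ (cong sum (sym (map-∘ ys))) (sum-map-cartesianProduct f xs ys) ⟩
  sum (map (λ y → f (x , y)) ys) + sum (map (λ x → sum (map (λ y → f (x , y)) ys)) xs)
    ∎
  where open ≡-Reasoning

sum-map-grid : ∀ {n} (f : Fin n × Fin n → ℕ) →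
  sum (map f (cartesianProduct (allFin n) (allFin n))) ≡ ∑[ a < n ] ∑[ b < n ] f (a , b)
sum-map-grid {n} f = begin
  sum (map f (cartesianProduct (allFin n) (allFin n)))
    ≡⟨ sum-map-cartesianProduct f (allFin n) (allFin n) ⟩
  sum (map (λ a → sum (map (λ b → f (a , b)) (allFin n))) (allFin n))
    ≡⟨ sum-map-tabulate (λ a → sum (map (λ b → f (a , b)) (allFin n))) (λ a → a) ⟩
  ∑[ a < n ] sum (map (λ b → f (a , b)) (allFin n))
    ≡⟨ ∑-cong (λ a → sum-map-tabulate (λ b → f (a , b)) (λ b → b)) ⟩
  ∑[ a < n ] ∑[ b < n ] f (a , b)
    ∎
  where open ≡-Reasoning

length-filter-T? : ∀ {A : Set} (p : A → Bool) xs → length (filter (T? ∘ p) xs) ≡ sum (map (iverson ∘ p) xs)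
length-filter-T? p []       = refl
length-filter-T? p (x ∷ xs) with p x
... | true  = cong suc (length-filter-T? p xs)
... | false = length-filter-T? p xs

Matrix : ℕ → Set
Matrix n = Fin n → Fin n → Bool

module _ {n : ℕ} where

  rowSum : Matrix n → Fin n → ℕ
  rowSum M i = ∑[ j < n ] iverson (M i j)

  transpose : Matrix n → Matrix n
  transpose M i j = M j i

  colSum : Matrix n → Fin n → ℕ
  colSum M = rowSum (transpose M)

  complement : Matrix n → Matrix n
  complement M i j = not (M i j)

  total : Matrix n → ℕ
  total M = ∑[ i < n ] rowSum M i

  total-transpose : ∀ M → total (transpose M) ≡ total M
  total-transpose M = ∑-comm (λ i j → iverson (M j i))

  rowSum-complement : ∀ M i → rowSum M i + rowSum (complement M) i ≡ n
  rowSum-complement M i = begin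
    rowSum M i + rowSum (complement M) i
      ≡⟨ ∑-distrib-+ (iverson ∘ M i) (iverson ∘ complement M i) ⟨
    ∑[ j < n ] (iverson (M i j) + iverson (not (M i j)))
      ≡⟨ ∑-cong (λ j → iverson+iverson-not (M i j)) ⟩
    ∑[ j < n ] 1
      ≡⟨ trans (∑-const n 1) (*-identityʳ n) ⟩
    n
      ∎
    where
    open ≡-Reasoning
    iverson+iverson-not : ∀ b → iverson b + iverson (not b) ≡ 1
    iverson+iverson-not true  = refl
    iverson+iverson-not false = refl

  total-complement : ∀ M → total M + total (complement M) ≡ n * n
  total-complement M = begin
    total M + total (complement M)
      ≡⟨ ∑-distrib-+ (rowSum M) (rowSum (complement M)) ⟨
    ∑[ i < n ] (rowSum M i + rowSum (complement M) i)
      ≡⟨ ∑-cong (rowSum-complement M) ⟩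
    ∑[ i < n ] n
      ≡⟨ ∑-const n n ⟩
    n * n
      ∎
    where open ≡-Reasoning

  rowSum-complement-≡ : ∀ (M : Matrix n) {i t} → rowSum M i ≡ t → rowSum (complement M) i ≡ n ∸ t
  rowSum-complement-≡ M {i} refl =
    trans (sym (m+n∸m≡n (rowSum M i) _)) (cong (_∸ rowSum M i) (rowSum-complement M i))

circulant : (n t : ℕ) .{{_ : NonZero n}} → Matrix n
circulant n t a b = (toℕ a + toℕ b) % n <ᵇ t

module _ {n t : ℕ} .{{_ : NonZero n}} (t≤n : t ≤ n) where

  rowSum-circulant : ∀ a → rowSum (circulant n t) a ≡ t
  rowSum-circulant a = begin
    ∑[ b < n ] iverson ((toℕ a + toℕ b) % n <ᵇ t)
      ≡⟨ ∑-shift-periodic (λ x → iverson (x % n <ᵇ t))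
                          (λ x → cong (λ y → iverson (y <ᵇ t)) ([m+n]%n≡m%n x n)) (toℕ a) ⟩
    ∑[ b < n ] iverson (toℕ b % n <ᵇ t)
      ≡⟨ ∑-cong (λ b → cong (λ y → iverson (y <ᵇ t)) (m<n⇒m%n≡m (toℕ<n b))) ⟩
    ∑[ b < n ] iverson (toℕ b <ᵇ t)
      ≡⟨ ∑-<ᵇ t≤n ⟩
    t
      ∎
    where open ≡-Reasoning

  colSum-circulant : ∀ b → colSum (circulant n t) b ≡ t
  colSum-circulant b =
    trans (∑-cong {n} (λ a → cong (λ y → iverson (y % n <ᵇ t)) (+-comm (toℕ a) (toℕ b)))) (rowSum-circulant b)

  total-circulant : total (circulant n t) ≡ t * n
  total-circulant = trans (∑-cong rowSum-circulant) (trans (∑-const n t) (*-comm n t))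

-- Distances in K_n × K_n

module _ (G : FinGraph) where
  open FinGraph G

  search-least : ∀ {x y d} i fuel → i ≤ d → d < i + fuel →
                 T (reach G d x y) → (∀ {k} → k < d → ¬ T (reach G k x y)) →
                 search G i fuel x y ≡ d
  search-least {d = d} i zero i≤d d<i+0 _ _ = contradiction (subst (d <_) (+-identityʳ i) d<i+0) (≤⇒≯ i≤d)
  search-least {x} {y} {d} i (suc fuel) i≤d d<i+fuel hit miss with i <? d
  ... | no i≮d with refl ← ≤∧≮⇒≡ i≤d i≮d with reach G i x y | hit
  ...   | true | _ = refl
  search-least {x} {y} {d} i (suc fuel) i≤d d<i+fuel hit miss | yes i<d with reach G i x y | miss i<d
  ...   | true  | not-reached = contradiction _ not-reached
  ...   | false | _           = search-least (suc i) fuel i<d (subst (d <_) (+-suc i fuel) d<i+fuel) hit miss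

  dist-least : ∀ {x y d} → d < length verts →
               T (reach G d x y) → (∀ {k} → k < d → ¬ T (reach G k x y)) → dist G x y ≡ d
  dist-least d<∣V∣ = search-least 0 (length verts) z≤n d<∣V∣

  reach-step : ∀ {k x w y} → T (reach G k x w) → w ∈ verts → T (adj w y) → T (reach G (suc k) x y)
  reach-step x⇝w w∈V w~y =
    Equivalence.from T-∨ (inj₂ (any⁺ _ (Any.map (λ { refl → Equivalence.from T-∧ (x⇝w , w~y) }) w∈V)))

  reach-step⁻ : ∀ {k x y} → T (reach G (suc k) x y) →
                T (reach G k x y) ⊎ ∃[ w ] T (reach G k x w) × T (adj w y)
  reach-step⁻ = Sum.map₂ (Product.map₂ (Equivalence.to T-∧) ∘ Any.satisfied ∘ any⁻ _ verts) ∘ Equivalence.to T-∨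

fresh : ∀ {n} → 3 ≤ n → (p q : Fin n) → ∃[ k ] p ≢ k × q ≢ k
fresh (s≤s (s≤s (s≤s _))) p q with p ≟ zero | q ≟ zero
... | no p≢0 | no q≢0 = zero , p≢0 , q≢0
... | yes refl | _ with q ≟ suc zero
...   | no q≢1   = suc zero , (λ ()) , q≢1
...   | yes refl = suc (suc zero) , (λ ()) , (λ ())
fresh (s≤s (s≤s (s≤s _))) p q | no p≢0 | yes refl with p ≟ suc zero
...   | no p≢1   = suc zero , p≢1 , (λ ())
...   | yes refl = suc (suc zero) , (λ ()) , (λ ())

lineDist : Bool → Bool → ℕ
lineDist true  true  = 0
lineDist false false = 1
lineDist true  false = 2
lineDist false true  = 2

lineDist-comm : ∀ p q → lineDist p q ≡ lineDist q p
lineDist-comm true  true  = refl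
lineDist-comm true  false = refl
lineDist-comm false true  = refl
lineDist-comm false false = refl

-- Below, p, p', q, q' stand for a = i, a = i', b = j, b = j', where z = (a , b) is compared
-- with x = (i , j) and y = (i' , j').
lineDist-sameRow : ∀ p {q q'} → ¬ T (q ∧ q') →
  ∣ lineDist p q - lineDist p q' ∣ ≡ iverson q + iverson q' + iverson p * iverson q + iverson p * iverson q'
lineDist-sameRow _     {true}  {true}  q∧q'≢⊤ = ⊥-elim (q∧q'≢⊤ _)
lineDist-sameRow true  {true}  {false} _ = refl
lineDist-sameRow false {true}  {false} _ = refl
lineDist-sameRow true  {false} {true}  _ = refl
lineDist-sameRow false {false} {true}  _ = refl
lineDist-sameRow true  {false} {false} _ = refl
lineDist-sameRow false {false} {false} _ = refl

lineDist-adjacent : ∀ {p p' q q'} → ¬ T (p ∧ p') → ¬ T (q ∧ q') →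
  iverson p + iverson p' + iverson q + iverson q' ≤
  ∣ lineDist p q - lineDist p' q' ∣ +
  (iverson p * iverson q + iverson p' * iverson q' + 2 * (iverson p * iverson q') + 2 * (iverson p' * iverson q))
lineDist-adjacent {true}  {true}  p∧p'≢⊤ _ = ⊥-elim (p∧p'≢⊤ _)
lineDist-adjacent {q = true} {true} _ q∧q'≢⊤ = ⊥-elim (q∧q'≢⊤ _)
lineDist-adjacent {true}  {false} {true}  {false} _ _ = ≤ᵇ⇒≤ _ _ _
lineDist-adjacent {true}  {false} {false} {true}  _ _ = ≤ᵇ⇒≤ _ _ _
lineDist-adjacent {true}  {false} {false} {false} _ _ = ≤ᵇ⇒≤ _ _ _
lineDist-adjacent {false} {true}  {true}  {false} _ _ = ≤ᵇ⇒≤ _ _ _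
lineDist-adjacent {false} {true}  {false} {true}  _ _ = ≤ᵇ⇒≤ _ _ _
lineDist-adjacent {false} {true}  {false} {false} _ _ = ≤ᵇ⇒≤ _ _ _
lineDist-adjacent {false} {false} {true}  {false} _ _ = ≤ᵇ⇒≤ _ _ _
lineDist-adjacent {false} {false} {false} {true}  _ _ = ≤ᵇ⇒≤ _ _ _
lineDist-adjacent {false} {false} {false} {false} _ _ = ≤ᵇ⇒≤ _ _ _

≟-disjoint : ∀ {n} {j j' : Fin n} → j ≢ j' → ∀ b → ¬ T (does (j ≟ b) ∧ does (j' ≟ b))
≟-disjoint {j = j} {j'} j≢j' b with j ≟ b | j' ≟ b
... | yes refl | yes refl = λ _ → j≢j' refl
... | yes _    | no _     = λ ()
... | no _     | _        = λ ()

module _ {n : ℕ} where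
  open FinGraph (KnxKn n) using (verts; eqV; adj)

  ∈-verts : ∀ x → x ∈ verts
  ∈-verts (a , b) = ∈-cartesianProduct⁺ (∈-allFin a) (∈-allFin b)

  eqV-refl : ∀ x → T (eqV x x)
  eqV-refl (i , j) rewrite dec-true (i ≟ i) refl | dec-true (j ≟ j) refl = _

  eqV-sound : ∀ {x y} → T (eqV x y) → x ≡ y
  eqV-sound {i , j} {a , b} x≈y with i ≟ a | j ≟ b
  ... | yes refl | yes refl = refl
  ... | yes _    | no _     = ⊥-elim x≈y
  ... | no _     | _        = ⊥-elim x≈y

  adj-intro : ∀ {i j a b : Fin n} → i ≢ a → j ≢ b → T (adj (i , j) (a , b))
  adj-intro {i} {j} {a} {b} i≢a j≢b rewrite dec-false (i ≟ a) i≢a | dec-false (j ≟ b) j≢b = _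

  adj-elim : ∀ {i j a b : Fin n} → T (adj (i , j) (a , b)) → i ≢ a × j ≢ b
  adj-elim {i} {j} {a} {b} x~y with i ≟ a | j ≟ b
  ... | no i≢a | no j≢b = i≢a , j≢b
  ... | no _   | yes _  = ⊥-elim x~y
  ... | yes _  | _      = ⊥-elim x~y

  reach-one : ∀ {i j a b : Fin n} → i ≢ a → j ≢ b → T (reach (KnxKn n) 1 (i , j) (a , b))
  reach-one {i} {j} {a} {b} i≢a j≢b =
    reach-step (KnxKn n) {0} {i , j} {i , j} {a , b} (eqV-refl (i , j)) (∈-verts (i , j)) (adj-intro i≢a j≢b)

  reach-two : 3 ≤ n → ∀ x y → T (reach (KnxKn n) 2 x y)
  reach-two 3≤n (i , j) (a , b) =
    let k , i≢k , a≢k = fresh 3≤n i a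
        l , j≢l , b≢l = fresh 3≤n j b
    in reach-step (KnxKn n) {1} {i , j} {k , l} {a , b} (reach-one i≢k j≢l) (∈-verts (k , l))
                  (adj-intro (≢-sym a≢k) (≢-sym b≢l))

  not-reach-one : ∀ {x y} → x ≢ y → ¬ T (adj x y) → ¬ T (reach (KnxKn n) 1 x y)
  not-reach-one {x} {y} x≢y x≁y x⇝y with reach-step⁻ (KnxKn n) {0} {x} {y} x⇝y
  ... | inj₁ x≈y = x≢y (eqV-sound x≈y)
  ... | inj₂ (w , x≈w , w~y) with refl ← eqV-sound {x} {w} x≈w = x≁y w~y

  dist≡2 : 3 ≤ n → ∀ {x y} → x ≢ y → ¬ T (adj x y) → dist (KnxKn n) x y ≡ 2
  dist≡2 3≤n@(s≤s (s≤s (s≤s _))) {x} {y} x≢y x≁y =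
    dist-least (KnxKn n) {x} {y} (s≤s (s≤s (s≤s z≤n))) (reach-two 3≤n x y) miss
    where
    miss : ∀ {k} → k < 2 → ¬ T (reach (KnxKn n) k x y)
    miss z<s       = x≢y ∘ eqV-sound
    miss (s<s z<s) = not-reach-one x≢y x≁y

  dist-lineDist : 3 ≤ n → ∀ {i j a b : Fin n} (i≟a : Dec (i ≡ a)) (j≟b : Dec (j ≡ b)) →
                  dist (KnxKn n) (i , j) (a , b) ≡ lineDist (does i≟a) (does j≟b)
  dist-lineDist (s≤s (s≤s (s≤s _))) {i} {j} (yes refl) (yes refl) =
    dist-least (KnxKn n) {i , j} {i , j} (s≤s z≤n) (eqV-refl (i , j)) (λ ())
  dist-lineDist (s≤s (s≤s (s≤s _))) {i} {j} {a} {b} (no i≢a) (no j≢b) =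
    dist-least (KnxKn n) {i , j} {a , b} (s≤s (s≤s z≤n)) (reach-one i≢a j≢b)
      (λ { z<s → i≢a ∘ cong proj₁ ∘ eqV-sound {i , j} {a , b} })
  dist-lineDist 3≤n {i} {j} {_} {b} (yes refl) (no j≢b) =
    dist≡2 3≤n (j≢b ∘ cong proj₂) (λ x~y → proj₁ (adj-elim {i} {j} {i} {b} x~y) refl)
  dist-lineDist 3≤n {i} {j} {a} {_} (no i≢a) (yes refl) =
    dist≡2 3≤n (i≢a ∘ cong proj₁) (λ x~y → proj₂ (adj-elim {i} {j} {a} {j} x~y) refl)

  kDist : Fin n × Fin n → Fin n × Fin n → ℕ
  kDist (i , j) (a , b) = lineDist (does (i ≟ a)) (does (j ≟ b))

  dist≡kDist : 3 ≤ n → ∀ x y → dist (KnxKn n) x y ≡ kDist x y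
  dist≡kDist 3≤n (i , j) (a , b) = dist-lineDist 3≤n (i ≟ a) (j ≟ b)

-- Δ_S in K_n × K_n

module _ {n : ℕ} where

  ∑∈ : (Fin n × Fin n → Bool) → (Fin n × Fin n → ℕ) → ℕ
  ∑∈ S w = ∑[ a < n ] ∑[ b < n ] (w (a , b) * iverson (S (a , b)))

  syntax ∑∈ S (λ z → w) = ∑[ z ∈ S ] w

  onRow : Fin n → Fin n × Fin n → ℕ
  onRow i z = δ i (proj₁ z)

  onColumn : Fin n → Fin n × Fin n → ℕ
  onColumn j z = δ j (proj₂ z)

  at : Fin n × Fin n → Fin n × Fin n → ℕ
  at (i , j) z = onRow i z * onColumn j z

  module _ {S : Fin n × Fin n → Bool} {f g : Fin n × Fin n → ℕ} where

    ∑∈-cong : (∀ z → f z ≡ g z) → ∑[ z ∈ S ] f z ≡ ∑[ z ∈ S ] g z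
    ∑∈-cong f≗g = ∑-cong (λ a → ∑-cong (λ b → cong (_* _) (f≗g (a , b))))

    ∑∈-mono-≤ : (∀ z → f z ≤ g z) → ∑[ z ∈ S ] f z ≤ ∑[ z ∈ S ] g z
    ∑∈-mono-≤ f≤g = ∑-mono-≤ (λ a → ∑-mono-≤ (λ b → *-monoˡ-≤ _ (f≤g (a , b))))

    ∑∈-+ : ∑[ z ∈ S ] (f z + g z) ≡ ∑[ z ∈ S ] f z + ∑[ z ∈ S ] g z
    ∑∈-+ = begin
      ∑[ a < n ] ∑[ b < n ] ((f (a , b) + g (a , b)) * s a b)
        ≡⟨ ∑-cong (λ a → ∑-cong (λ b → *-distribʳ-+ (s a b) (f (a , b)) (g (a , b)))) ⟩
      ∑[ a < n ] ∑[ b < n ] (f (a , b) * s a b + g (a , b) * s a b)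
        ≡⟨ ∑-cong (λ a → ∑-distrib-+ (λ b → f (a , b) * s a b) (λ b → g (a , b) * s a b)) ⟩
      ∑[ a < n ] (∑[ b < n ] (f (a , b) * s a b) + ∑[ b < n ] (g (a , b) * s a b))
        ≡⟨ ∑-distrib-+ (λ a → ∑[ b < n ] (f (a , b) * s a b)) (λ a → ∑[ b < n ] (g (a , b) * s a b)) ⟩
      ∑[ z ∈ S ] f z + ∑[ z ∈ S ] g z
        ∎
      where
      open ≡-Reasoning
      s : Fin n → Fin n → ℕ
      s a b = iverson (S (a , b))

  module _ {S : Fin n × Fin n → Bool} {f : Fin n × Fin n → ℕ} where

    ∑∈-* : ∀ c → ∑[ z ∈ S ] (c * f z) ≡ c * ∑[ z ∈ S ] f z
    ∑∈-* c = begin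
      ∑[ a < n ] ∑[ b < n ] (c * f (a , b) * s a b)
        ≡⟨ ∑-cong (λ a → ∑-cong (λ b → *-assoc c (f (a , b)) (s a b))) ⟩
      ∑[ a < n ] ∑[ b < n ] (c * (f (a , b) * s a b))
        ≡⟨ ∑-cong (λ a → *-distribˡ-sum c (λ b → f (a , b) * s a b)) ⟨
      ∑[ a < n ] (c * ∑[ b < n ] (f (a , b) * s a b))
        ≡⟨ *-distribˡ-sum c (λ a → ∑[ b < n ] (f (a , b) * s a b)) ⟨
      c * ∑[ z ∈ S ] f z
        ∎
      where
      open ≡-Reasoning
      s : Fin n → Fin n → ℕ
      s a b = iverson (S (a , b))

  module _ {S : Fin n × Fin n → Bool} where

    ∑∈-+₄ : ∀ f₁ f₂ f₃ f₄ → ∑[ z ∈ S ] (f₁ z + f₂ z + f₃ z + f₄ z) ≡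
            ∑[ z ∈ S ] f₁ z + ∑[ z ∈ S ] f₂ z + ∑[ z ∈ S ] f₃ z + ∑[ z ∈ S ] f₄ z
    ∑∈-+₄ f₁ f₂ f₃ f₄ =
      trans (∑∈-+ {S} {λ z → f₁ z + f₂ z + f₃ z} {f₄})
        (cong (_+ _) (trans (∑∈-+ {S} {λ z → f₁ z + f₂ z} {f₃}) (cong (_+ _) (∑∈-+ {S} {f₁} {f₂}))))

    ∑∈-row : ∀ i → ∑[ z ∈ S ] onRow i z ≡ rowSum (curry S) i
    ∑∈-row i = begin
      ∑[ a < n ] ∑[ b < n ] (δ i a * iverson (S (a , b)))
        ≡⟨ ∑-cong (λ a → *-distribˡ-sum (δ i a) (λ b → iverson (S (a , b)))) ⟨
      ∑[ a < n ] (δ i a * rowSum (curry S) a)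
        ≡⟨ ∑-δ i (rowSum (curry S)) ⟩
      rowSum (curry S) i
        ∎
      where open ≡-Reasoning

    ∑∈-column : ∀ j → ∑[ z ∈ S ] onColumn j z ≡ colSum (curry S) j
    ∑∈-column j = ∑-cong (λ a → ∑-δ j (λ b → iverson (S (a , b))))

    ∑∈-point : ∀ i j → ∑[ z ∈ S ] at (i , j) z ≡ iverson (S (i , j))
    ∑∈-point i j = begin
      ∑[ a < n ] ∑[ b < n ] (δ i a * δ j b * iverson (S (a , b)))
        ≡⟨ ∑-cong (λ a → ∑-cong (λ b → *-assoc (δ i a) (δ j b) _)) ⟩
      ∑[ a < n ] ∑[ b < n ] (δ i a * (δ j b * iverson (S (a , b))))
        ≡⟨ ∑-cong (λ a → *-distribˡ-sum (δ i a) (λ b → δ j b * iverson (S (a , b)))) ⟨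
      ∑[ a < n ] (δ i a * ∑[ b < n ] (δ j b * iverson (S (a , b))))
        ≡⟨ ∑-cong (λ a → cong (δ i a *_) (∑-δ j (λ b → iverson (S (a , b))))) ⟩
      ∑[ a < n ] (δ i a * iverson (S (a , j)))
        ≡⟨ ∑-δ i (λ a → iverson (S (a , j))) ⟩
      iverson (S (i , j))
        ∎
      where open ≡-Reasoning

  ∑∈-swap : ∀ (S : Fin n × Fin n → Bool) (w : Fin n × Fin n → ℕ) → ∑[ z ∈ S ] w z ≡ ∑[ z ∈ S ∘ swap ] w (swap z)
  ∑∈-swap S w = ∑-comm (λ a b → w (a , b) * iverson (S (a , b)))

module _ {n : ℕ} (3≤n : 3 ≤ n) where

  ΔS≡∑∈ : ∀ S x y → ΔS (KnxKn n) S x y ≡ ∑[ z ∈ S ] ∣ kDist x z - kDist y z ∣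
  ΔS≡∑∈ S x y = trans (sum-map-grid (λ z → if S z then ∣ dist (KnxKn n) x z - dist (KnxKn n) y z ∣ else 0))
                      (∑-cong (λ a → ∑-cong (λ b → begin
    (if S (a , b) then ∣ dist (KnxKn n) x (a , b) - dist (KnxKn n) y (a , b) ∣ else 0)
      ≡⟨ if-then-0≡*iverson (S (a , b)) _ ⟩
    ∣ dist (KnxKn n) x (a , b) - dist (KnxKn n) y (a , b) ∣ * iverson (S (a , b))
      ≡⟨ cong₂ (λ u v → ∣ u - v ∣ * iverson (S (a , b))) (dist≡kDist 3≤n x (a , b)) (dist≡kDist 3≤n y (a , b)) ⟩
    ∣ kDist x (a , b) - kDist y (a , b) ∣ * iverson (S (a , b))
      ∎)))
    where open ≡-Reasoning

  ΔS-swap : ∀ S x y → ΔS (KnxKn n) S x y ≡ ΔS (KnxKn n) (S ∘ swap) (swap x) (swap y)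
  ΔS-swap S x@(i , j) y@(i' , j') = begin
    ΔS (KnxKn n) S x y
      ≡⟨ ΔS≡∑∈ S x y ⟩
    ∑[ z ∈ S ] ∣ kDist x z - kDist y z ∣
      ≡⟨ ∑∈-swap S (λ z → ∣ kDist x z - kDist y z ∣) ⟩
    ∑[ z ∈ S ∘ swap ] ∣ kDist x (swap z) - kDist y (swap z) ∣
      ≡⟨ ∑∈-cong (λ (a , b) → cong₂ ∣_-_∣ (lineDist-comm (does (i ≟ b)) (does (j ≟ a)))
                                          (lineDist-comm (does (i' ≟ b)) (does (j' ≟ a)))) ⟩
    ∑[ z ∈ S ∘ swap ] ∣ kDist (swap x) z - kDist (swap y) z ∣
      ≡⟨ ΔS≡∑∈ (S ∘ swap) (swap x) (swap y) ⟨
    ΔS (KnxKn n) (S ∘ swap) (swap x) (swap y)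
      ∎
    where open ≡-Reasoning

  ΔS-sameRow : ∀ S i {j j'} → j ≢ j' →
    ΔS (KnxKn n) S (i , j) (i , j') ≡
    colSum (curry S) j + colSum (curry S) j' + iverson (S (i , j)) + iverson (S (i , j'))
  ΔS-sameRow S i {j} {j'} j≢j' = begin
    ΔS (KnxKn n) S (i , j) (i , j')
      ≡⟨ ΔS≡∑∈ S (i , j) (i , j') ⟩
    ∑[ z ∈ S ] ∣ kDist (i , j) z - kDist (i , j') z ∣
      ≡⟨ ∑∈-cong (λ z → lineDist-sameRow (does (i ≟ proj₁ z)) (≟-disjoint j≢j' (proj₂ z))) ⟩
    ∑[ z ∈ S ] (onColumn j z + onColumn j' z + at (i , j) z + at (i , j') z)
      ≡⟨ ∑∈-+₄ (onColumn j) (onColumn j') (at (i , j)) (at (i , j')) ⟩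
    ∑[ z ∈ S ] onColumn j z + ∑[ z ∈ S ] onColumn j' z + ∑[ z ∈ S ] at (i , j) z + ∑[ z ∈ S ] at (i , j') z
      ≡⟨ cong₂ _+_ (cong₂ _+_ (cong₂ _+_ (∑∈-column j) (∑∈-column j')) (∑∈-point i j)) (∑∈-point i j') ⟩
    colSum (curry S) j + colSum (curry S) j' + iverson (S (i , j)) + iverson (S (i , j'))
      ∎
    where open ≡-Reasoning

  ΔS-sameColumn : ∀ S {i i'} j → i ≢ i' →
    ΔS (KnxKn n) S (i , j) (i' , j) ≡
    rowSum (curry S) i + rowSum (curry S) i' + iverson (S (i , j)) + iverson (S (i' , j))
  ΔS-sameColumn S {i} {i'} j i≢i' = trans (ΔS-swap S (i , j) (i' , j)) (ΔS-sameRow (S ∘ swap) j i≢i')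

  ΔS-adjacent : ∀ S {i i' j j'} → i ≢ i' → j ≢ j' →
    rowSum (curry S) i + rowSum (curry S) i' + colSum (curry S) j + colSum (curry S) j' ≤
    ΔS (KnxKn n) S (i , j) (i' , j') + 6
  ΔS-adjacent S {i} {i'} {j} {j'} i≢i' j≢j' = begin
    rowSum (curry S) i + rowSum (curry S) i' + colSum (curry S) j + colSum (curry S) j'
      ≡⟨ cong₂ _+_ (cong₂ _+_ (cong₂ _+_ (∑∈-row i) (∑∈-row i')) (∑∈-column j)) (∑∈-column j') ⟨
    ∑[ z ∈ S ] onRow i z + ∑[ z ∈ S ] onRow i' z + ∑[ z ∈ S ] onColumn j z + ∑[ z ∈ S ] onColumn j' z
      ≡⟨ ∑∈-+₄ (onRow i) (onRow i') (onColumn j) (onColumn j') ⟨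
    ∑[ z ∈ S ] (onRow i z + onRow i' z + onColumn j z + onColumn j' z)
      ≤⟨ ∑∈-mono-≤ (λ (a , b) → lineDist-adjacent {does (i ≟ a)} {does (i' ≟ a)} {does (j ≟ b)} {does (j' ≟ b)}
                                                  (≟-disjoint i≢i' a) (≟-disjoint j≢j' b)) ⟩
    ∑[ z ∈ S ] (∣ kDist (i , j) z - kDist (i' , j') z ∣ + corners z)
      ≡⟨ ∑∈-+ {S = S} {f = λ z → ∣ kDist (i , j) z - kDist (i' , j') z ∣} {g = corners} ⟩
    ∑[ z ∈ S ] ∣ kDist (i , j) z - kDist (i' , j') z ∣ + ∑[ z ∈ S ] corners z
      ≤⟨ +-mono-≤ (≤-reflexive (sym (ΔS≡∑∈ S (i , j) (i' , j')))) corners≤6 ⟩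
    ΔS (KnxKn n) S (i , j) (i' , j') + 6
      ∎
    where
    open ≤-Reasoning
    corners : Fin n × Fin n → ℕ
    corners z = at (i , j) z + at (i' , j') z + 2 * at (i , j') z + 2 * at (i' , j) z
    corners≤6 : ∑[ z ∈ S ] corners z ≤ 6
    corners≤6 = begin
      ∑[ z ∈ S ] corners z
        ≡⟨ ∑∈-+₄ (at (i , j)) (at (i' , j')) (λ z → 2 * at (i , j') z) (λ z → 2 * at (i' , j) z) ⟩
      ∑[ z ∈ S ] at (i , j) z + ∑[ z ∈ S ] at (i' , j') z +
      ∑[ z ∈ S ] (2 * at (i , j') z) + ∑[ z ∈ S ] (2 * at (i' , j) z)
        ≡⟨ cong₂ _+_ (cong₂ _+_ (cong₂ _+_ (∑∈-point i j) (∑∈-point i' j'))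
                                (trans (∑∈-* {S = S} {f = at (i , j')} 2) (cong (2 *_) (∑∈-point i j'))))
                     (trans (∑∈-* {S = S} {f = at (i' , j)} 2) (cong (2 *_) (∑∈-point i' j))) ⟩
      iverson (S (i , j)) + iverson (S (i' , j')) + 2 * iverson (S (i , j')) + 2 * iverson (S (i' , j))
        ≤⟨ +-mono-≤ (+-mono-≤ (+-mono-≤ (iverson≤1 (S (i , j))) (iverson≤1 (S (i' , j'))))
                              (*-monoʳ-≤ 2 (iverson≤1 (S (i , j')))))
                    (*-monoʳ-≤ 2 (iverson≤1 (S (i' , j)))) ⟩
      6 ∎

-- The lower bound

heavyColumn-arith : ∀ {n c C r σ t} → 2 ≤ n → t < c → r + σ ≡ n →
  n * c + C + 2 * t ≤ n * (2 * t) + σ + 2 * c → (n ∸ 2) * (c ∸ suc t) + C + r ≤ t * n + 2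
heavyColumn-arith {suc (suc k)} {C = C} {r} {σ} {t} (s≤s (s≤s _)) t<c r+σ≡n summed
  with e , refl ← m≤n⇒∃[o]m+o≡n t<c rewrite m+n∸m≡n (suc t) e =
  +-cancelʳ-≤ Q (k * e + C + r) (t * (2 + k) + 2) (begin
    k * e + C + r + Q
      ≡⟨ lhs k e C r t ⟩
    (2 + k) * (suc t + e) + C + 2 * t + r
      ≤⟨ +-monoˡ-≤ r summed ⟩
    (2 + k) * (2 * t) + σ + 2 * (suc t + e) + r
      ≡⟨ regroup ((2 + k) * (2 * t)) σ (2 * (suc t + e)) r ⟩
    (2 + k) * (2 * t) + (r + σ) + 2 * (suc t + e)
      ≡⟨ cong (λ m → (2 + k) * (2 * t) + m + 2 * (suc t + e)) r+σ≡n ⟩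
    (2 + k) * (2 * t) + (2 + k) + 2 * (suc t + e)
      ≡⟨ rhs k e t ⟩
    t * (2 + k) + 2 + Q
      ∎)
  where
  open ≤-Reasoning
  Q : ℕ
  Q = 2 + 4 * t + 2 * e + k + k * t
  lhs : ∀ k e C r t → k * e + C + r + (2 + 4 * t + 2 * e + k + k * t) ≡ (2 + k) * (suc t + e) + C + 2 * t + r
  lhs = solve-∀
  regroup : ∀ a σ b r → a + σ + b + r ≡ a + (r + σ) + b
  regroup = solve-∀
  rhs : ∀ k e t → (2 + k) * (2 * t) + (2 + k) + 2 * (suc t + e) ≡ t * (2 + k) + 2 + (2 + 4 * t + 2 * e + k + k * t)
  rhs = solve-∀

module _ {n : ℕ} where

  ColumnPairBound : ℕ → Matrix n → Set
  ColumnPairBound t A = ∀ i {j j'} → j ≢ j' →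
    colSum A j + colSum A j' ≤ 2 * t + iverson (not (A i j)) + iverson (not (A i j'))

  0<colSum⇒∃ : ∀ {A : Matrix n} {a} → 0 < colSum A a → ∃[ i ] T (A i a)
  0<colSum⇒∃ {A} {a} 0<c = Product.map₂ iverson>0⇒T (∑>⇒∃> (λ i → iverson (A i a)) 0<c)

  module _ {t : ℕ} {A : Matrix n} (bound : ColumnPairBound t A) where

    -- Sum the pair bound for columns a and j along row i over all j ≠ a; the δ a j terms make
    -- the summand for j = a an identity.
    heavyColumn-bound : 2 ≤ n → ∀ {a i} → t < colSum A a → T (A i a) →
                        (n ∸ 2) * (colSum A a ∸ suc t) + total A + rowSum A i ≤ t * n + 2
    heavyColumn-bound 2≤n {a} {i} t<c Aia =
      heavyColumn-arith 2≤n t<c (rowSum-complement A i) (begin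
        n * c + total A + 2 * t
          ≡⟨ lhs ⟨
        ∑[ j < n ] (c + colSum A j + δ a j * (2 * t))
          ≤⟨ ∑-mono-≤ pointwise ⟩
        ∑[ j < n ] (2 * t + iverson (not (A i j)) + δ a j * (2 * c))
          ≡⟨ rhs ⟩
        n * (2 * t) + rowSum (complement A) i + 2 * c
          ∎)
      where
      open ≤-Reasoning
      c : ℕ
      c = colSum A a
      σᵢₐ≡0 : iverson (not (A i a)) ≡ 0
      σᵢₐ≡0 = T⇒iverson-not≡0 {A i a} Aia
      pointwise : ∀ j → c + colSum A j + δ a j * (2 * t) ≤ 2 * t + iverson (not (A i j)) + δ a j * (2 * c)
      pointwise j with a ≟ j
      ... | yes refl rewrite σᵢₐ≡0 = ≤-reflexive (diag c t)
        where
        diag : ∀ c t → c + c + 1 * (2 * t) ≡ 2 * t + 0 + 1 * (2 * c)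
        diag = solve-∀
      ... | no a≢j = begin
        c + colSum A j + 0
          ≡⟨ +-identityʳ _ ⟩
        c + colSum A j
          ≤⟨ bound i a≢j ⟩
        2 * t + iverson (not (A i a)) + iverson (not (A i j))
          ≡⟨ cong (λ σ → 2 * t + σ + iverson (not (A i j))) σᵢₐ≡0 ⟩
        2 * t + 0 + iverson (not (A i j))
          ≡⟨ +-assoc (2 * t) 0 _ ⟩
        2 * t + iverson (not (A i j))
          ≡⟨ +-identityʳ _ ⟨
        2 * t + iverson (not (A i j)) + 0
          ∎
      lhs : ∑[ j < n ] (c + colSum A j + δ a j * (2 * t)) ≡ n * c + total A + 2 * t
      lhs = begin-equality
        ∑[ j < n ] (c + colSum A j + δ a j * (2 * t))
          ≡⟨ ∑-distrib-+ (λ j → c + colSum A j) (λ j → δ a j * (2 * t)) ⟩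
        ∑[ j < n ] (c + colSum A j) + ∑[ j < n ] (δ a j * (2 * t))
          ≡⟨ cong₂ _+_ (∑-distrib-+ (λ _ → c) (colSum A)) (∑-δ a (λ _ → 2 * t)) ⟩
        ∑[ j < n ] c + total (transpose A) + 2 * t
          ≡⟨ cong₂ (λ x y → x + y + 2 * t) (∑-const n c) (total-transpose A) ⟩
        n * c + total A + 2 * t
          ∎
      rhs : ∑[ j < n ] (2 * t + iverson (not (A i j)) + δ a j * (2 * c)) ≡ n * (2 * t) + rowSum (complement A) i + 2 * c
      rhs = begin-equality
        ∑[ j < n ] (2 * t + iverson (not (A i j)) + δ a j * (2 * c))
          ≡⟨ ∑-distrib-+ (λ j → 2 * t + iverson (not (A i j))) (λ j → δ a j * (2 * c)) ⟩
        ∑[ j < n ] (2 * t + iverson (not (A i j))) + ∑[ j < n ] (δ a j * (2 * c))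
          ≡⟨ cong₂ _+_ (∑-distrib-+ (λ _ → 2 * t) (λ j → iverson (not (A i j)))) (∑-δ a (λ _ → 2 * c)) ⟩
        ∑[ j < n ] (2 * t) + rowSum (complement A) i + 2 * c
          ≡⟨ cong (λ x → x + rowSum (complement A) i + 2 * c) (∑-const n (2 * t)) ⟩
        n * (2 * t) + rowSum (complement A) i + 2 * c
          ∎

    heavyColumn⇒total≤ : 3 ≤ n → ∀ {a} → 2 + t ≤ colSum A a → total A ≤ t * n
    heavyColumn⇒total≤ 3≤n {a} 2+t≤c = +-cancelʳ-≤ 2 (total A) (t * n) (begin
      total A + 2
        ≡⟨ +-suc (total A) 1 ⟩
      1 + total A + 1
        ≤⟨ +-mono-≤ (+-monoˡ-≤ (total A) 1≤excess) 1≤rᵢ ⟩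
      (n ∸ 2) * (colSum A a ∸ suc t) + total A + rowSum A i
        ≤⟨ heavyColumn-bound (≤-trans (n≤1+n 2) 3≤n) t<c Aia ⟩
      t * n + 2
        ∎)
      where
      open ≤-Reasoning
      t<c : t < colSum A a
      t<c = ≤-trans (n≤1+n (suc t)) 2+t≤c
      witness : ∃[ i ] T (A i a)
      witness = 0<colSum⇒∃ {A} {a} (≤-trans (s≤s z≤n) t<c)
      i = proj₁ witness
      Aia = proj₂ witness
      1≤rᵢ : 1 ≤ rowSum A i
      1≤rᵢ = subst (_≤ rowSum A i) (T⇒iverson≡1 {A i a} Aia) (term≤∑ (λ j → iverson (A i j)) a)
      1≤excess : 1 ≤ (n ∸ 2) * (colSum A a ∸ suc t)
      1≤excess = *-mono-≤ (∸-monoˡ-≤ 2 3≤n) (subst (_≤ colSum A a ∸ suc t) (m+n∸n≡m 1 t) (∸-monoˡ-≤ (suc t) 2+t≤c))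

    heavyColumns-unique : ∀ {j j'} → t < colSum A j → t < colSum A j' → j ≡ j'
    heavyColumns-unique {j} {j'} t<c t<c′ with j ≟ j'
    ... | yes j≡j' = j≡j'
    ... | no  j≢j' = contradiction (trans (∑-cong column-empty) (sum-replicate-zero n)) (>⇒≢ (≤-trans (s≤s z≤n) t<c))
      where
      column-empty : ∀ i → iverson (A i j) ≡ 0
      column-empty i = 2≤iverson-not⇒iverson≡0 (A i j) (A i j') (+-cancelˡ-≤ (2 * t) 2 _ (begin
        2 * t + 2
          ≡⟨ two-t+2 t ⟩
        suc t + suc t
          ≤⟨ +-mono-≤ t<c t<c′ ⟩
        colSum A j + colSum A j'
          ≤⟨ bound i j≢j' ⟩
        2 * t + iverson (not (A i j)) + iverson (not (A i j'))
          ≡⟨ +-assoc (2 * t) _ _ ⟩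
        2 * t + (iverson (not (A i j)) + iverson (not (A i j')))
          ∎))
        where
        open ≤-Reasoning
        two-t+2 : ∀ t → 2 * t + 2 ≡ suc t + suc t
        two-t+2 = solve-∀

module _ {n : ℕ} where

  pairBounds⇒total≤ : ∀ {t} {A : Matrix n} → 3 ≤ n → 2 ≤ t →
                      ColumnPairBound t A → ColumnPairBound t (transpose A) → total A ≤ t * n
  pairBounds⇒total≤ {t} {A} 3≤n 2≤t columnBound rowBound with total A ≤? t * n
  ... | yes C≤tn = C≤tn
  ... | no  C≰tn = contradiction t≤1 (<⇒≱ 2≤t)
    where
    open ≤-Reasoning
    tn<C : t * n < total A
    tn<C = ≰⇒> C≰tn
    heavy : ∃[ a ] t < colSum A a
    heavy = ∑>⇒∃> (colSum A) (subst (t * n <_) (sym (total-transpose A)) tn<C)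
    a = proj₁ heavy
    witness : ∃[ i ] T (A i a)
    witness = 0<colSum⇒∃ {A = A} {a} (≤-trans (s≤s z≤n) (proj₂ heavy))
    i₀ = proj₁ witness
    rᵢ₀≤1 : rowSum A i₀ ≤ 1
    rᵢ₀≤1 = +-cancelˡ-≤ (suc (t * n)) (rowSum A i₀) 1 (begin
      suc (t * n) + rowSum A i₀
        ≤⟨ +-monoˡ-≤ (rowSum A i₀) tn<C ⟩
      total A + rowSum A i₀
        ≤⟨ +-monoˡ-≤ (rowSum A i₀) (m≤n+m (total A) _) ⟩
      (n ∸ 2) * (colSum A a ∸ suc t) + total A + rowSum A i₀
        ≤⟨ heavyColumn-bound {t = t} {A} columnBound (≤-trans (n≤1+n 2) 3≤n) (proj₂ heavy) (proj₂ witness) ⟩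
      t * n + 2
        ≡⟨ +-suc (t * n) 1 ⟩
      suc (t * n) + 1
        ∎)
    rows≤ : ∀ i → rowSum A i ≤ suc t
    rows≤ i = ≮⇒≥ λ 1+t<r → C≰tn
      (subst (_≤ t * n) (total-transpose A) (heavyColumn⇒total≤ {t = t} {transpose A} rowBound 3≤n 1+t<r))
    t≤1 : t ≤ 1
    t≤1 = +-cancelˡ-≤ (suc (t * n)) t 1 (begin
      suc (t * n) + t
        ≤⟨ +-monoˡ-≤ t tn<C ⟩
      total A + t
        ≤⟨ ∑-nearlyBounded (rowSum A) i₀ rᵢ₀≤1 rows≤ (heavyColumns-unique {t = t} {transpose A} rowBound) ⟩
      t * n + 2
        ≡⟨ +-suc (t * n) 1 ⟩
      suc (t * n) + 1
        ∎)

complementary-pair-bound : ∀ {n t u v c c′ s s′} → t ≤ n → u + c ≡ n → v + c′ ≡ n →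
                           2 * n ∸ 2 * t ≤ u + v + s + s′ → c + c′ ≤ 2 * t + s + s′
complementary-pair-bound {n} {t} {u} {v} {c} {c′} {s} {s′} t≤n u+c≡n v+c′≡n separated =
  +-cancelˡ-≤ D (c + c′) (2 * t + s + s′) (begin
    D + (c + c′)                   ≡⟨ +-comm D (c + c′) ⟩
    c + c′ + D                     ≤⟨ +-monoʳ-≤ (c + c′) separated ⟩
    c + c′ + (u + v + s + s′)      ≡⟨ regroup c c′ u v s s′ ⟩
    (u + c) + (v + c′) + (s + s′)  ≡⟨ cong₂ (λ x y → x + y + (s + s′)) u+c≡n v+c′≡n ⟩
    n + n + (s + s′)               ≡⟨ cong (_+ (s + s′)) (trans (two-n n) (sym (m∸n+n≡m (*-monoʳ-≤ 2 t≤n)))) ⟩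
    D + 2 * t + (s + s′)           ≡⟨ reassoc D t s s′ ⟩
    D + (2 * t + s + s′)           ∎)
  where
  open ≤-Reasoning
  D : ℕ
  D = 2 * n ∸ 2 * t
  regroup : ∀ c c′ u v s s′ → c + c′ + (u + v + s + s′) ≡ (u + c) + (v + c′) + (s + s′)
  regroup = solve-∀
  two-n : ∀ n → n + n ≡ 2 * n
  two-n = solve-∀
  reassoc : ∀ D t s s′ → D + 2 * t + (s + s′) ≡ D + (2 * t + s + s′)
  reassoc = solve-∀

module _ {n : ℕ} where

  ColumnPairSeparation : ℕ → Matrix n → Set
  ColumnPairSeparation k M = ∀ i {j j'} → j ≢ j' →
    k ≤ colSum M j + colSum M j' + iverson (M i j) + iverson (M i j')

  separation⇒columnPairBound : ∀ {t} {M : Matrix n} → t ≤ n →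
    ColumnPairSeparation (2 * n ∸ 2 * t) M → ColumnPairBound t (complement M)
  separation⇒columnPairBound {t} {M} t≤n separated i {j} {j'} j≢j'
    rewrite not-involutive (M i j) | not-involutive (M i j') =
    complementary-pair-bound {u = colSum M j} {colSum M j'} {colSum (complement M) j} {colSum (complement M) j'}
                             t≤n (rowSum-complement (transpose M) j) (rowSum-complement (transpose M) j')
                             (separated i j≢j')

  module _ {k : ℕ} {S : Fin n × Fin n → Bool} (3≤n : 3 ≤ n) (resolving : IsWeakKResolving (KnxKn n) k S) where

    resolving⇒columnPairSeparation : ColumnPairSeparation k (curry S)
    resolving⇒columnPairSeparation i j≢j' =
      subst (k ≤_) (ΔS-sameRow 3≤n S i j≢j') (resolving _ _ (j≢j' ∘ cong proj₂))

    resolving⇒rowPairSeparation : ColumnPairSeparation k (transpose (curry S))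
    resolving⇒rowPairSeparation j i≢i' =
      subst (k ≤_) (ΔS-sameColumn 3≤n S j i≢i') (resolving _ _ (i≢i' ∘ cong proj₁))

  card≡total : ∀ S → card (KnxKn n) S ≡ total (curry S)
  card≡total S = trans (length-filter-T? S (cartesianProduct (allFin n) (allFin n))) (sum-map-grid (iverson ∘ S))

  resolving⇒card≥ : ∀ {t S} → 3 ≤ n → 2 ≤ t → t ≤ n →
    IsWeakKResolving (KnxKn n) (2 * n ∸ 2 * t) S → n * n ∸ t * n ≤ card (KnxKn n) S
  resolving⇒card≥ {t} {S} 3≤n 2≤t t≤n resolving = begin
    n * n ∸ t * n
      ≤⟨ ∸-monoʳ-≤ (n * n) missing≤tn ⟩
    n * n ∸ total (complement M)
      ≡⟨ cong (_∸ total (complement M)) (total-complement M) ⟨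
    total M + total (complement M) ∸ total (complement M)
      ≡⟨ m+n∸n≡m (total M) (total (complement M)) ⟩
    total M
      ≡⟨ card≡total S ⟨
    card (KnxKn n) S
      ∎
    where
    open ≤-Reasoning
    M : Matrix n
    M = curry S
    missing≤tn : total (complement M) ≤ t * n
    missing≤tn = pairBounds⇒total≤ 3≤n 2≤t
      (separation⇒columnPairBound t≤n (resolving⇒columnPairSeparation 3≤n resolving))
      (separation⇒columnPairBound t≤n (resolving⇒rowPairSeparation 3≤n resolving))

-- The upper bound

module _ {n : ℕ} where

  double≤sum : ∀ {u a b s s′} → a ≡ u → b ≡ u → 2 * u ≤ a + b + s + s′
  double≤sum {u} {s = s} {s′} refl refl =
    ≤-trans (≤-reflexive (cong (u +_) (+-identityʳ u))) (≤-trans (m≤m+n (u + u) s) (m≤m+n (u + u + s) s′))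

  regular⇒resolving : ∀ {u} {M : Matrix n} → 3 ≤ n → 3 ≤ u →
    (∀ i → rowSum M i ≡ u) → (∀ j → colSum M j ≡ u) → IsWeakKResolving (KnxKn n) (2 * u) (uncurry M)
  regular⇒resolving {u} {M} 3≤n 3≤u rows cols (i , j) (i' , j') x≢y with i ≟ i' | j ≟ j'
  ... | yes refl | yes refl = contradiction refl x≢y
  ... | yes refl | no j≢j'  = begin
    2 * u
      ≤⟨ double≤sum (cols j) (cols j') ⟩
    colSum M j + colSum M j' + iverson (M i j) + iverson (M i j')
      ≡⟨ ΔS-sameRow 3≤n (uncurry M) i j≢j' ⟨
    ΔS (KnxKn n) (uncurry M) (i , j) (i , j')
      ∎
    where open ≤-Reasoning
  ... | no i≢i'  | yes refl = begin
    2 * u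
      ≤⟨ double≤sum (rows i) (rows i') ⟩
    rowSum M i + rowSum M i' + iverson (M i j) + iverson (M i' j)
      ≡⟨ ΔS-sameColumn 3≤n (uncurry M) j i≢i' ⟨
    ΔS (KnxKn n) (uncurry M) (i , j) (i' , j)
      ∎
    where open ≤-Reasoning
  ... | no i≢i'  | no j≢j'  = +-cancelʳ-≤ 6 (2 * u) _ (begin
    2 * u + 6
      ≤⟨ +-monoʳ-≤ (2 * u) (*-monoʳ-≤ 2 3≤u) ⟩
    2 * u + 2 * u
      ≡⟨ four-u u ⟩
    u + u + u + u
      ≡⟨ cong₂ _+_ (cong₂ _+_ (cong₂ _+_ (rows i) (rows i')) (cols j)) (cols j') ⟨
    rowSum M i + rowSum M i' + colSum M j + colSum M j'
      ≤⟨ ΔS-adjacent 3≤n (uncurry M) i≢i' j≢j' ⟩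
    ΔS (KnxKn n) (uncurry M) (i , j) (i' , j') + 6
      ∎)
    where
    open ≤-Reasoning
    four-u : ∀ u → 2 * u + 2 * u ≡ u + u + u + u
    four-u = solve-∀

module _ {n t : ℕ} .{{_ : NonZero n}} (t≤n : t ≤ n) where

  circulantComplement-resolving : 3 ≤ n ∸ t →
    IsWeakKResolving (KnxKn n) (2 * n ∸ 2 * t) (uncurry (complement (circulant n t)))
  circulantComplement-resolving 3≤n∸t =
    subst (λ k → IsWeakKResolving (KnxKn n) k (uncurry (complement (circulant n t)))) (*-distribˡ-∸ 2 n t)
      (regular⇒resolving (≤-trans 3≤n∸t (m∸n≤m n t)) 3≤n∸t
        (λ i → rowSum-complement-≡ (circulant n t) (rowSum-circulant t≤n i))
        (λ j → rowSum-complement-≡ (transpose (circulant n t)) (colSum-circulant t≤n j)))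

  circulantComplement-card : card (KnxKn n) (uncurry (complement (circulant n t))) ≡ n * n ∸ t * n
  circulantComplement-card = begin
    card (KnxKn n) (uncurry (complement C))
      ≡⟨ card≡total (uncurry (complement C)) ⟩
    total (complement C)
      ≡⟨ m+n∸m≡n (total C) (total (complement C)) ⟨
    total C + total (complement C) ∸ total C
      ≡⟨ cong₂ _∸_ (total-complement C) (total-circulant t≤n) ⟩
    n * n ∸ t * n
      ∎
    where
    open ≡-Reasoning
    C : Matrix n
    C = circulant n t

mainTheorem9 : ∀ (n t : ℕ) → 4 ≤ n → 2 ≤ t → t ≤ n ∸ 3 →
    WDimIs (KnxKn n) (2 * n ∸ 2 * t) (n * n ∸ t * n)
mainTheorem9 n t 4≤n 2≤t t≤n∸3 =
  (uncurry (complement (circulant n t)) , circulantComplement-resolving t≤n 3≤n∸t , circulantComplement-card t≤n) ,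
  λ _ → resolving⇒card≥ 3≤n 2≤t t≤n
  where
  3≤n : 3 ≤ n
  3≤n = ≤-trans (n≤1+n 3) 4≤n
  t≤n : t ≤ n
  t≤n = ≤-trans t≤n∸3 (m∸n≤m n 3)
  3≤n∸t : 3 ≤ n ∸ t
  3≤n∸t = subst (_≤ n ∸ t) (m∸[m∸n]≡n 3≤n) (∸-monoʳ-≤ n t≤n∸3)
  instance
    n≢0 : NonZero n
    n≢0 = >-nonZero (≤-trans (s≤s z≤n) 3≤n)
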